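{- Let $K$ be a naturally ordered commutative semiring with at least three elements, and let $\tau=\{U\}$ with $U$ unary. The formula $\psi(x)=\exists y\,(Uy\wedge y\neq x)$ does not have a Gaifman normal form over $K$, i.e., there is no positive Boolean combination of local formulae with free variable $x$ and basic local sentences which is $K$-equivalent to $\psi(x)$.
   Context: $K=(K,+,\cdot,0,1)$ is commutative with $0\ne1$; naturally ordered means $a\le b:\iff\exists c\,(a+c=b)$ is a partial order. A $K$-interpretation is a map $\pi$ from the instantiated literals $Ua,\neg Ua$ ($a\in A$, $A$ finite) to $K$; it is model-defining (exactly one of $\pi(Ua),\pi(\neg Ua)$ is $0$) and tracks only positive information ($\pi(\neg Ua)\in\{0,1\}$); all interpretations considered are of this kind. Formulae are in negation normal form, evaluated by: $a=a\mapsto1$, $a=b\mapsto0$ for $a\ne b$ (dually for $\ne$), literals via $\pi$, $\vee\mapsto+$, $\wedge\mapsto\cdot$, $\exists x\mapsto$ sum over $A$, $\forall x\mapsto$ product over $A$. Gaifman graph: distinct $a,b$ adjacent iff they occur together in a positive literal with nonzero value (for unary $\tau$ there are no edges); $B^\pi_r(a)$ is the set of elements at distance $\le r$ from $a$. Ball quantifiers $\exists y\in B_r(x)$, $\forall y\in B_r(x)$ are evaluated as sum/product over $b\in B^\pi_r(a)$. An $r$-local formula $\varphi^{(r)}(\bar x)$ is built from literals, equalities and inequalities using $\wedge,\vee$ and ball quantifiers only, such that in its quantification dag (edge $z\to y$ labelled $r'$ for each quantifier $Qz\in B_{r'}(y)$) every path ending in a free variable has label sum $\le r$. $d(x,y)\le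 r$ abbreviates $\exists x'\in B_r(x)(x'=y)$, $d(x,y)>r$ abbreviates $\forall x'\in B_r(x)(x'\ne y)$. Basic local sentences: $\exists x_1\dots\exists x_m(\bigwedge_{i<j}d(x_i,x_j)>2r\wedge\bigwedge_i\varphi^{(r)}(x_i))$ or $\forall x_1\dots\forall x_m(\bigvee_{i<j}d(x_i,x_j)\le2r\vee\bigvee_i\varphi^{(r)}(x_i))$ with $\varphi^{(r)}(x)$ $r$-local around one variable. $\varphi(x)$ and $\psi(x)$ are $K$-equivalent if $\pi[\![\varphi(a)]\!]=\pi[\![\psi(a)]\!]$ for all interpretations $\pi$ and elements $a$. -}

module Defs where

open import Level using (Level; _⊔_)
open import Algebra.Bundles using (CommutativeSemiring)
open import Data.Nat using (ℕ; zero; suc; _≤_) renaming (_⊔_ to _⊔ℕ_; _+_ to _+ℕ_)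
  renaming (_*_ to _*ℕ_)
open import Data.Fin using (Fin; zero; suc; _≟_)
open import Data.List using (List; []; _∷_; foldr; allFin)
open import Data.Product using (Σ; ∃; _×_; _,_)
open import Data.Sum using (_⊎_)
open import Relation.Nullary using (¬_; yes; no)
open import Relation.Binary.PropositionalEquality using (_≡_)

-- Formulae are in negation
-- normal form; variables are de Bruijn indices: a formula of type
-- Formula k has its variables among Fin k (index zero = most recently
-- bound variable).

data Formula (k : ℕ) : Set where
  eqF neqF     : Fin k → Fin k → Formula k
  posU negU    : Fin k → Formula k
  orF andF     : Formula k → Formula k → Formula k
  exF allF     : Formula (suc k) → Formula k
  -- ball quantifiers  ∃ z ∈ B_r(x_i) φ ,  ∀ z ∈ B_r(x_i) φ
  exBallF allBallF : ℕ → Fin k → Formula (suc k) → Formula k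

data LFormula (k : ℕ) : Set where
  eqL neqL     : Fin k → Fin k → LFormula k
  posL negL    : Fin k → LFormula k
  orL andL     : LFormula k → LFormula k → LFormula k
  exBallL allBallL : ℕ → Fin k → LFormula (suc k) → LFormula k

liftRen : ∀ {k k'} → (Fin k → Fin k') → Fin (suc k) → Fin (suc k')
liftRen ρ zero    = zero
liftRen ρ (suc i) = suc (ρ i)

rename : ∀ {k k'} → (Fin k → Fin k') → Formula k → Formula k'
rename ρ (eqF i j)         = eqF (ρ i) (ρ j)
rename ρ (neqF i j)        = neqF (ρ i) (ρ j)
rename ρ (posU i)          = posU (ρ i)
rename ρ (negU i)          = negU (ρ i)
rename ρ (orF φ ψ)         = orF (rename ρ φ) (rename ρ ψ)
rename ρ (andF φ ψ)        = andF (rename ρ φ) (rename ρ ψ)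
rename ρ (exF φ)           = exF (rename (liftRen ρ) φ)
rename ρ (allF φ)          = allF (rename (liftRen ρ) φ)
rename ρ (exBallF r i φ)   = exBallF r (ρ i) (rename (liftRen ρ) φ)
rename ρ (allBallF r i φ)  = allBallF r (ρ i) (rename (liftRen ρ) φ)

embedL : ∀ {k} → LFormula k → Formula k
embedL (eqL i j)        = eqF i j
embedL (neqL i j)       = neqF i j
embedL (posL i)         = posU i
embedL (negL i)         = negU i
embedL (orL φ ψ)        = orF (embedL φ) (embedL ψ)
embedL (andL φ ψ)       = andF (embedL φ) (embedL ψ)
embedL (exBallL r i φ)  = exBallF r i (embedL φ)
embedL (allBallL r i φ) = allBallF r i (embedL φ)

-- Quantification dag: for a quantifier  Q z ∈ B_{r'}(y)  there is an edge
-- z → y labelled r'.  reach φ y = maximal label sum of a path in the dag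
-- of φ ending in the variable y (0 for the empty path).
reach : ∀ {k} → LFormula k → Fin k → ℕ
reach (eqL _ _)   _ = 0
reach (neqL _ _)  _ = 0
reach (posL _)    _ = 0
reach (negL _)    _ = 0
reach (orL φ ψ)   y = reach φ y ⊔ℕ reach ψ y
reach (andL φ ψ)  y = reach φ y ⊔ℕ reach ψ y
reach (exBallL r i φ)  y = reach φ (suc y) ⊔ℕ edgeTo r i φ y
  where
  edgeTo : ∀ {k} → ℕ → Fin k → LFormula (suc k) → Fin k → ℕ
  edgeTo r i φ y with i ≟ y
  ... | yes _ = r +ℕ reach φ zero
  ... | no  _ = 0
reach (allBallL r i φ) y = reach φ (suc y) ⊔ℕ edgeTo r i φ y
  where
  edgeTo : ∀ {k} → ℕ → Fin k → LFormula (suc k) → Fin k → ℕ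
  edgeTo r i φ y with i ≟ y
  ... | yes _ = r +ℕ reach φ zero
  ... | no  _ = 0

IsLocal : ℕ → LFormula 1 → Set
IsLocal r φ = reach φ zero ≤ r

bigAnd : ∀ {k} → Formula k → List (Formula k) → Formula k
bigAnd φ = foldr andF φ
bigOr : ∀ {k} → Formula k → List (Formula k) → Formula k
bigOr φ = foldr orF φ

exs : ∀ m → Formula m → Formula 0
exs zero    φ = φ
exs (suc m) φ = exs m (exF φ)
alls : ∀ m → Formula m → Formula 0
alls zero    φ = φ
alls (suc m) φ = alls m (allF φ)

pairsFrom : ∀ {m} → List (Fin m) → List (Fin m × Fin m)
pairsFrom []       = []
pairsFrom (i ∷ is) = Data.List.map (λ j → (i , j)) is Data.List.++ pairsFrom is
  where import Data.List

pairs : ∀ m → List (Fin m × Fin m)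
pairs m = pairsFrom (allFin m)

-- d(x_i , x_j) > R  :=  ∀ x' ∈ B_R(x_i) (x' ≠ x_j)
-- d(x_i , x_j) ≤ R  :=  ∃ x' ∈ B_R(x_i) (x' = x_j)
distGt distLe : ∀ {m} → ℕ → Fin m → Fin m → Formula m
distGt R i j = allBallF R i (neqF zero (suc j))
distLe R i j = exBallF R i (eqF zero (suc j))

at : ∀ {m} → LFormula 1 → Fin m → Formula m
at φ i = rename (λ _ → i) (embedL φ)

-- Basic local sentences (m ≥ 1, written suc m):
--  ∃x_1..∃x_m ( ⋀_{i<j} d(x_i,x_j) > 2r  ∧  ⋀_i φ(x_i) )
--  ∀x_1..∀x_m ( ⋁_{i<j} d(x_i,x_j) ≤ 2r  ∨  ⋁_i φ(x_i) )
basicEx : ℕ → ℕ → LFormula 1 → Formula 0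
basicEx m r φ = exs (suc m)
  (bigAnd (at φ zero)
    (Data.List.map (λ p → distGt (2 *ℕ r) (Data.Product.proj₁ p) (Data.Product.proj₂ p)) (pairs (suc m))
     Data.List.++ Data.List.map (λ i → at φ (suc i)) (allFin m)))
  where import Data.List ; import Data.Product

basicAll : ℕ → ℕ → LFormula 1 → Formula 0
basicAll m r φ = alls (suc m)
  (bigOr (at φ zero)
    (Data.List.map (λ p → distLe (2 *ℕ r) (Data.Product.proj₁ p) (Data.Product.proj₂ p)) (pairs (suc m))
     Data.List.++ Data.List.map (λ i → at φ (suc i)) (allFin m)))
  where import Data.List ; import Data.Product

data GNF : Set where
  localG    : (r : ℕ) (φ : LFormula 1) → IsLocal r φ → GNF
  basicExG  : (m r : ℕ) (φ : LFormula 1) → IsLocal r φ → GNF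
  basicAllG : (m r : ℕ) (φ : LFormula 1) → IsLocal r φ → GNF
  orG andG  : GNF → GNF → GNF

weaken0 : Formula 0 → Formula 1
weaken0 = rename (λ ())

toFormula : GNF → Formula 1
toFormula (localG r φ _)       = embedL φ
toFormula (basicExG m r φ _)   = weaken0 (basicEx m r φ)
toFormula (basicAllG m r φ _)  = weaken0 (basicAll m r φ)
toFormula (orG g h)            = orF (toFormula g) (toFormula h)
toFormula (andG g h)           = andF (toFormula g) (toFormula h)

psi : Formula 1
psi = exF (andF (posU zero) (neqF zero (suc zero)))

module Semantics {c ℓ : Level} (K : CommutativeSemiring c ℓ) where
  open CommutativeSemiring K

  _≤K_ : Carrier → Carrier → Set (c ⊔ ℓ)
  a ≤K b = Σ Carrier (λ d → (a + d) ≈ b)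

  -- K is naturally ordered: ≤K is a partial order (reflexivity and
  -- transitivity hold in every semiring; antisymmetry is the condition,
  -- but we state all three).
  NaturallyOrdered : Set (c ⊔ ℓ)
  NaturallyOrdered =
      (∀ a → a ≤K a)
    × (∀ a b d → a ≤K b → b ≤K d → a ≤K d)
    × (∀ a b → a ≤K b → b ≤K a → a ≈ b)

  AtLeastThree : Set (c ⊔ ℓ)
  AtLeastThree = Σ Carrier λ a → Σ Carrier λ b → Σ Carrier λ d →
    ¬ (a ≈ b) × ¬ (a ≈ d) × ¬ (b ≈ d)

  -- K-interpretation on universe A = Fin n (vocabulary {U}, U unary):
  -- values of the literals U a and ¬U a; model-defining and tracking only
  -- positive information.
  record Interp (n : ℕ) : Set (c ⊔ ℓ) where
    field
      pos neg      : Fin n → Carrier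
      modelDef     : ∀ a → ((pos a ≈ 0#) × ¬ (neg a ≈ 0#))
                         ⊎ (¬ (pos a ≈ 0#) × (neg a ≈ 0#))
      positiveOnly : ∀ a → (neg a ≈ 0#) ⊎ (neg a ≈ 1#)

  sumL prodL : ∀ {n} → (Fin n → Carrier) → List (Fin n) → Carrier
  sumL  f = foldr (λ b s → f b + s) 0#
  prodL f = foldr (λ b s → f b * s) 1#

  -- Gaifman ball B^π_r(a).  Since τ = {U} is unary, every positive
  -- literal U b mentions a single element, so the Gaifman graph of π has
  -- no edges and B^π_r(a) = {a} for every r.
  ball : ∀ {n} → Interp n → ℕ → Fin n → List (Fin n)
  ball π r a = a ∷ []

  extend : ∀ {k n} → Fin n → (Fin k → Fin n) → Fin (suc k) → Fin n
  extend b ρ zero    = b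
  extend b ρ (suc i) = ρ i

  eval : ∀ {n k} → Interp n → Formula k → (Fin k → Fin n) → Carrier
  eval π (eqF i j)  ρ with ρ i ≟ ρ j
  ... | yes _ = 1#
  ... | no  _ = 0#
  eval π (neqF i j) ρ with ρ i ≟ ρ j
  ... | yes _ = 0#
  ... | no  _ = 1#
  eval π (posU i)   ρ = Interp.pos π (ρ i)
  eval π (negU i)   ρ = Interp.neg π (ρ i)
  eval π (orF φ ψ)  ρ = eval π φ ρ + eval π ψ ρ
  eval π (andF φ ψ) ρ = eval π φ ρ * eval π ψ ρ
  eval {n} π (exF φ)  ρ = sumL  (λ b → eval π φ (extend b ρ)) (allFin n)
  eval {n} π (allF φ) ρ = prodL (λ b → eval π φ (extend b ρ)) (allFin n)
  eval π (exBallF r i φ)  ρ = sumL  (λ b → eval π φ (extend b ρ)) (ball π r (ρ i))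
  eval π (allBallF r i φ) ρ = prodL (λ b → eval π φ (extend b ρ)) (ball π r (ρ i))

  KEquivalent : Formula 1 → Formula 1 → Set (c ⊔ ℓ)
  KEquivalent φ ψ = ∀ (n : ℕ) (π : Interp n) (a : Fin n) →
    eval π φ (λ _ → a) ≈ eval π ψ (λ _ → a)

  HasGaifmanNF : Formula 1 → Set (c ⊔ ℓ)
  HasGaifmanNF ψ = Σ GNF λ g → KEquivalent (toFormula g) ψ

  ZeroNeOne : Set ℓ
  ZeroNeOne = ¬ (0# ≈ 1#)

-- Since U is unary, the Gaifman graph has no edges and every ball B_r(a) is {a}:
-- an r-local formula φ(x) only ever inspects the element x, and a basic local
-- sentence does not depend on x at all.  Hence the value of a Gaifman normal form
-- at a is monotone, in the natural order, in the value of U a.  But ψ is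
-- antitone: on a two-element universe with U-values 1 and s it takes the value s
-- at the first element and 1 at the second.  So every s ≠ 0 comparable with 1
-- equals 1; applied to 1 + t ≥ 1 and then to t ≤ 1 + t = 1 this makes every
-- nonzero element equal to 1, leaving no room for a third element.
module Submission where

open import Defs
open import Level using (Level)
open import Algebra.Bundles using (CommutativeSemiring)
import Algebra.Properties.CommutativeSemigroup as CommutativeSemigroupProperties
open import Data.Empty using (⊥-elim)
open import Function using (_∘_)
open import Data.Nat using (suc)
open import Data.Fin using (Fin; zero; suc; _≟_)
open import Data.List using ([]; _∷_; allFin)
open import Data.List.Properties using (foldr-cong)
open import Data.Product using (_,_; proj₂)
open import Data.Sum using (_⊎_; inj₁; inj₂)
open import Relation.Nullary using (¬_; yes; no)
open import Relation.Binary.PropositionalEquality as ≡ using (_≡_)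

module _ {c ℓ : Level} (K : CommutativeSemiring c ℓ) where
  open CommutativeSemiring K hiding (zero)
  open Semantics K
  open import Relation.Binary.Reasoning.Setoid setoid

  ≈⇒≤K : ∀ {a b} → a ≈ b → a ≤K b
  ≈⇒≤K {a} a≈b = 0# , trans (+-identityʳ a) a≈b

  ≤K-resp-≈ : ∀ {a b a′ b′} → a ≈ a′ → b ≈ b′ → a ≤K b → a′ ≤K b′
  ≤K-resp-≈ a≈a′ b≈b′ (d , a+d≈b) = d , trans (+-cong (sym a≈a′) refl) (trans a+d≈b b≈b′)

  +-mono-≤K : ∀ {a a′ b b′} → a ≤K a′ → b ≤K b′ → (a + b) ≤K (a′ + b′)
  +-mono-≤K {a} {a′} {b} {b′} (d , a+d≈a′) (e , b+e≈b′) = d + e , (begin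
    (a + b) + (d + e)  ≈⟨ interchange a b d e ⟩
    (a + d) + (b + e)  ≈⟨ +-cong a+d≈a′ b+e≈b′ ⟩
    a′ + b′            ∎)
    where open CommutativeSemigroupProperties +-commutativeSemigroup using (interchange)

  *-mono-≤K : ∀ {a a′ b b′} → a ≤K a′ → b ≤K b′ → (a * b) ≤K (a′ * b′)
  *-mono-≤K {a} {a′} {b} {b′} (d , a+d≈a′) (e , b+e≈b′) = (a * e + d * b) + d * e , (begin
    a * b + ((a * e + d * b) + d * e)  ≈⟨ sym (+-assoc (a * b) _ _) ⟩
    (a * b + (a * e + d * b)) + d * e  ≈⟨ +-cong (sym (+-assoc (a * b) _ _)) refl ⟩
    ((a * b + a * e) + d * b) + d * e  ≈⟨ +-assoc _ (d * b) (d * e) ⟩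
    (a * b + a * e) + (d * b + d * e)  ≈⟨ +-cong (sym (distribˡ a b e)) (sym (distribˡ d b e)) ⟩
    a * (b + e) + d * (b + e)          ≈⟨ sym (distribʳ (b + e) a d) ⟩
    (a + d) * (b + e)                  ≈⟨ *-cong a+d≈a′ b+e≈b′ ⟩
    a′ * b′                            ∎)

  nonzero-is-one⇒¬AtLeastThree : (∀ t → ¬ t ≈ 0# → t ≈ 1#) → ¬ AtLeastThree
  nonzero-is-one⇒¬AtLeastThree one (a , b , d , a≉b , a≉d , b≉d) = a≉b (both-nonzero a≉0 b≉0)
    where
    both-nonzero : ∀ {x y} → ¬ x ≈ 0# → ¬ y ≈ 0# → x ≈ y
    both-nonzero {x} {y} x≉0 y≉0 = trans (one x x≉0) (sym (one y y≉0))

    both-zero : ∀ {x y} → x ≈ 0# → y ≈ 0# → x ≈ y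
    both-zero x≈0 y≈0 = trans x≈0 (sym y≈0)

    a≉0 : ¬ a ≈ 0#
    a≉0 a≈0 = b≉d (both-nonzero (a≉b ∘ both-zero a≈0) (a≉d ∘ both-zero a≈0))

    b≉0 : ¬ b ≈ 0#
    b≉0 b≈0 = a≉d (both-nonzero a≉0 (b≉d ∘ both-zero b≈0))

  sumL-cong : ∀ {n} {f g : Fin n → Carrier} → (∀ b → f b ≡ g b) → ∀ l → sumL f l ≡ sumL g l
  sumL-cong f≗g = foldr-cong (λ b s → ≡.cong (_+ s) (f≗g b)) ≡.refl

  prodL-cong : ∀ {n} {f g : Fin n → Carrier} → (∀ b → f b ≡ g b) → ∀ l → prodL f l ≡ prodL g l
  prodL-cong f≗g = foldr-cong (λ b s → ≡.cong (_* s) (f≗g b)) ≡.refl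

  extend-cong : ∀ {k n} (b : Fin n) {σ σ′ : Fin k → Fin n} →
                (∀ i → σ i ≡ σ′ i) → ∀ i → extend b σ i ≡ extend b σ′ i
  extend-cong b σ≗σ′ zero    = ≡.refl
  extend-cong b σ≗σ′ (suc i) = σ≗σ′ i

  coincide-transfer : ∀ {k n} {σ σ′ : Fin k → Fin n} {i j} →
                      (∀ i → σ i ≡ σ′ i) → σ i ≡ σ j → σ′ i ≡ σ′ j
  coincide-transfer {i = i} {j} σ≗σ′ σi≡σj = ≡.trans (≡.sym (σ≗σ′ i)) (≡.trans σi≡σj (σ≗σ′ j))

  eval-cong : ∀ {n k} (π : Interp n) (φ : Formula k) {σ σ′ : Fin k → Fin n} →
              (∀ i → σ i ≡ σ′ i) → eval π φ σ ≡ eval π φ σ′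
  eval-cong π (eqF i j) {σ} {σ′} σ≗σ′ with σ i ≟ σ j | σ′ i ≟ σ′ j
  ... | yes _    | yes _    = ≡.refl
  ... | no  _    | no  _    = ≡.refl
  ... | yes σi≡σj | no σ′i≢σ′j = ⊥-elim (σ′i≢σ′j (coincide-transfer σ≗σ′ σi≡σj))
  ... | no σi≢σj  | yes σ′i≡σ′j = ⊥-elim (σi≢σj (coincide-transfer (≡.sym ∘ σ≗σ′) σ′i≡σ′j))
  eval-cong π (neqF i j) {σ} {σ′} σ≗σ′ with σ i ≟ σ j | σ′ i ≟ σ′ j
  ... | yes _    | yes _    = ≡.refl
  ... | no  _    | no  _    = ≡.refl
  ... | yes σi≡σj | no σ′i≢σ′j = ⊥-elim (σ′i≢σ′j (coincide-transfer σ≗σ′ σi≡σj))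
  ... | no σi≢σj  | yes σ′i≡σ′j = ⊥-elim (σi≢σj (coincide-transfer (≡.sym ∘ σ≗σ′) σ′i≡σ′j))
  eval-cong π (posU i)   σ≗σ′ = ≡.cong (Interp.pos π) (σ≗σ′ i)
  eval-cong π (negU i)   σ≗σ′ = ≡.cong (Interp.neg π) (σ≗σ′ i)
  eval-cong π (orF φ ψ)  σ≗σ′ = ≡.cong₂ _+_ (eval-cong π φ σ≗σ′) (eval-cong π ψ σ≗σ′)
  eval-cong π (andF φ ψ) σ≗σ′ = ≡.cong₂ _*_ (eval-cong π φ σ≗σ′) (eval-cong π ψ σ≗σ′)
  eval-cong {n} π (exF φ)  σ≗σ′ = sumL-cong  (λ b → eval-cong π φ (extend-cong b σ≗σ′)) (allFin n)
  eval-cong {n} π (allF φ) σ≗σ′ = prodL-cong (λ b → eval-cong π φ (extend-cong b σ≗σ′)) (allFin n)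
  eval-cong π (exBallF r i φ) {σ′ = σ′} σ≗σ′ rewrite σ≗σ′ i =
    sumL-cong (λ b → eval-cong π φ (extend-cong b σ≗σ′)) (σ′ i ∷ [])
  eval-cong π (allBallF r i φ) {σ′ = σ′} σ≗σ′ rewrite σ≗σ′ i =
    prodL-cong (λ b → eval-cong π φ (extend-cong b σ≗σ′)) (σ′ i ∷ [])

  extend-liftRen : ∀ {k k′ n} (b : Fin n) (ρ : Fin k → Fin k′) (σ : Fin k′ → Fin n) →
                   ∀ i → extend b σ (liftRen ρ i) ≡ extend b (λ j → σ (ρ j)) i
  extend-liftRen b ρ σ zero    = ≡.refl
  extend-liftRen b ρ σ (suc i) = ≡.refl

  eval-rename-extend : ∀ {n k k′} (π : Interp n) (φ : Formula (suc k)) (ρ : Fin k → Fin k′)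
                       (σ : Fin k′ → Fin n) (b : Fin n) →
                       eval π (rename (liftRen ρ) φ) (extend b σ) ≡ eval π φ (extend b (λ j → σ (ρ j)))

  eval-rename : ∀ {n k k′} (π : Interp n) (φ : Formula k) (ρ : Fin k → Fin k′) (σ : Fin k′ → Fin n) →
                eval π (rename ρ φ) σ ≡ eval π φ (λ i → σ (ρ i))
  eval-rename π (eqF i j) ρ σ with σ (ρ i) ≟ σ (ρ j)
  ... | yes _ = ≡.refl
  ... | no  _ = ≡.refl
  eval-rename π (neqF i j) ρ σ with σ (ρ i) ≟ σ (ρ j)
  ... | yes _ = ≡.refl
  ... | no  _ = ≡.refl
  eval-rename π (posU i)   ρ σ = ≡.refl
  eval-rename π (negU i)   ρ σ = ≡.refl
  eval-rename π (orF φ ψ)  ρ σ = ≡.cong₂ _+_ (eval-rename π φ ρ σ) (eval-rename π ψ ρ σ)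
  eval-rename π (andF φ ψ) ρ σ = ≡.cong₂ _*_ (eval-rename π φ ρ σ) (eval-rename π ψ ρ σ)
  eval-rename {n} π (exF φ)  ρ σ = sumL-cong  (eval-rename-extend π φ ρ σ) (allFin n)
  eval-rename {n} π (allF φ) ρ σ = prodL-cong (eval-rename-extend π φ ρ σ) (allFin n)
  eval-rename π (exBallF r i φ)  ρ σ = sumL-cong  (eval-rename-extend π φ ρ σ) (σ (ρ i) ∷ [])
  eval-rename π (allBallF r i φ) ρ σ = prodL-cong (eval-rename-extend π φ ρ σ) (σ (ρ i) ∷ [])

  eval-rename-extend π φ ρ σ b =
    ≡.trans (eval-rename π φ (liftRen ρ) (extend b σ)) (eval-cong π φ (extend-liftRen b ρ σ))

  eval-weaken0-constant : ∀ {n} (π : Interp n) (φ : Formula 0) (σ σ′ : Fin 1 → Fin n) →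
                          eval π (weaken0 φ) σ ≡ eval π (weaken0 φ) σ′
  eval-weaken0-constant π φ σ σ′ =
    ≡.trans (eval-rename π φ (λ ()) σ)
      (≡.trans (eval-cong π φ (λ ())) (≡.sym (eval-rename π φ (λ ()) σ′)))

  extend-constant : ∀ {k n} {u : Fin n} {σ : Fin k → Fin n} →
                    (∀ i → σ i ≡ u) → ∀ j i → extend (σ j) σ i ≡ u
  extend-constant σ≡u j zero    = σ≡u j
  extend-constant σ≡u j (suc i) = σ≡u i

  module _ {n} (π : Interp n) {u v : Fin n}
           (pos≤ : Interp.pos π u ≤K Interp.pos π v) (neg≈ : Interp.neg π u ≈ Interp.neg π v) where

    eval-local-mono : ∀ {k} (φ : LFormula k) {σ σ′ : Fin k → Fin n} →
                      (∀ i → σ i ≡ u) → (∀ i → σ′ i ≡ v) →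
                      eval π (embedL φ) σ ≤K eval π (embedL φ) σ′
    eval-local-mono (eqL i j) {σ} {σ′} σ≡u σ′≡v with σ i ≟ σ j | σ′ i ≟ σ′ j
    ... | yes _    | yes _     = ≈⇒≤K refl
    ... | no σi≢σj | _         = ⊥-elim (σi≢σj (≡.trans (σ≡u i) (≡.sym (σ≡u j))))
    ... | yes _    | no σ′i≢σ′j = ⊥-elim (σ′i≢σ′j (≡.trans (σ′≡v i) (≡.sym (σ′≡v j))))
    eval-local-mono (neqL i j) {σ} {σ′} σ≡u σ′≡v with σ i ≟ σ j | σ′ i ≟ σ′ j
    ... | yes _    | yes _     = ≈⇒≤K refl
    ... | no σi≢σj | _         = ⊥-elim (σi≢σj (≡.trans (σ≡u i) (≡.sym (σ≡u j))))
    ... | yes _    | no σ′i≢σ′j = ⊥-elim (σ′i≢σ′j (≡.trans (σ′≡v i) (≡.sym (σ′≡v j))))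
    eval-local-mono (posL i) σ≡u σ′≡v =
      ≡.subst₂ (λ x y → Interp.pos π x ≤K Interp.pos π y) (≡.sym (σ≡u i)) (≡.sym (σ′≡v i)) pos≤
    eval-local-mono (negL i) σ≡u σ′≡v =
      ≡.subst₂ (λ x y → Interp.neg π x ≤K Interp.neg π y) (≡.sym (σ≡u i)) (≡.sym (σ′≡v i)) (≈⇒≤K neg≈)
    eval-local-mono (orL φ ψ) σ≡u σ′≡v =
      +-mono-≤K (eval-local-mono φ σ≡u σ′≡v) (eval-local-mono ψ σ≡u σ′≡v)
    eval-local-mono (andL φ ψ) σ≡u σ′≡v =
      *-mono-≤K (eval-local-mono φ σ≡u σ′≡v) (eval-local-mono ψ σ≡u σ′≡v)
    eval-local-mono (exBallL r i φ) σ≡u σ′≡v =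
      +-mono-≤K (eval-local-mono φ (extend-constant σ≡u i) (extend-constant σ′≡v i)) (≈⇒≤K refl)
    eval-local-mono (allBallL r i φ) σ≡u σ′≡v =
      *-mono-≤K (eval-local-mono φ (extend-constant σ≡u i) (extend-constant σ′≡v i)) (≈⇒≤K refl)

    eval-GNF-mono : (g : GNF) → eval π (toFormula g) (λ _ → u) ≤K eval π (toFormula g) (λ _ → v)
    eval-GNF-mono (localG r φ _)      = eval-local-mono φ (λ _ → ≡.refl) (λ _ → ≡.refl)
    eval-GNF-mono (basicExG m r φ _)  = ≈⇒≤K (reflexive (eval-weaken0-constant π (basicEx m r φ) _ _))
    eval-GNF-mono (basicAllG m r φ _) = ≈⇒≤K (reflexive (eval-weaken0-constant π (basicAll m r φ) _ _))
    eval-GNF-mono (orG g h)           = +-mono-≤K (eval-GNF-mono g) (eval-GNF-mono h)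
    eval-GNF-mono (andG g h)          = *-mono-≤K (eval-GNF-mono g) (eval-GNF-mono h)

  module _ (0≉1 : ZeroNeOne) (s : Carrier) (s≉0 : ¬ s ≈ 0#) where

    twoPoint : Interp 2
    twoPoint = record
      { pos          = λ { zero → 1# ; (suc zero) → s }
      ; neg          = λ _ → 0#
      ; modelDef     = λ { zero → inj₂ (0≉1 ∘ sym , refl) ; (suc zero) → inj₂ (s≉0 , refl) }
      ; positiveOnly = λ _ → inj₁ refl
      }

    psi-twoPoint-zero : eval twoPoint psi (λ _ → zero) ≈ s
    psi-twoPoint-zero = begin
      1# * 0# + (s * 1# + 0#)  ≈⟨ +-cong (zeroʳ 1#) (+-identityʳ (s * 1#)) ⟩
      0# + s * 1#              ≈⟨ +-identityˡ (s * 1#) ⟩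
      s * 1#                   ≈⟨ *-identityʳ s ⟩
      s                        ∎

    psi-twoPoint-one : eval twoPoint psi (λ _ → suc zero) ≈ 1#
    psi-twoPoint-one = begin
      1# * 1# + (s * 0# + 0#)  ≈⟨ +-cong (*-identityʳ 1#) (trans (+-identityʳ (s * 0#)) (zeroʳ s)) ⟩
      1# + 0#                  ≈⟨ +-identityʳ 1# ⟩
      1#                       ∎

  module _ (0≉1 : ZeroNeOne) (ordered : NaturallyOrdered)
           (g : GNF) (g≡psi : KEquivalent (toFormula g) psi) where

    private
      antisym : ∀ a b → a ≤K b → b ≤K a → a ≈ b
      antisym = proj₂ (proj₂ ordered)

    module _ {s : Carrier} (s≉0 : ¬ s ≈ 0#) where
      private
        π : Interp 2
        π = twoPoint 0≉1 s s≉0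

        g-at-zero : eval π (toFormula g) (λ _ → zero) ≈ s
        g-at-zero = trans (g≡psi 2 π zero) (psi-twoPoint-zero 0≉1 s s≉0)

        g-at-one : eval π (toFormula g) (λ _ → suc zero) ≈ 1#
        g-at-one = trans (g≡psi 2 π (suc zero)) (psi-twoPoint-one 0≉1 s s≉0)

      1≤s⇒s≤1 : 1# ≤K s → s ≤K 1#
      1≤s⇒s≤1 1≤s = ≤K-resp-≈ g-at-zero g-at-one (eval-GNF-mono π 1≤s refl g)

      s≤1⇒1≤s : s ≤K 1# → 1# ≤K s
      s≤1⇒1≤s s≤1 = ≤K-resp-≈ g-at-one g-at-zero (eval-GNF-mono π s≤1 refl g)

    comparable-with-one⇒one : ∀ {s} → ¬ s ≈ 0# → (1# ≤K s) ⊎ (s ≤K 1#) → s ≈ 1#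
    comparable-with-one⇒one s≉0 (inj₁ 1≤s) = antisym _ _ (1≤s⇒s≤1 s≉0 1≤s) 1≤s
    comparable-with-one⇒one s≉0 (inj₂ s≤1) = antisym _ _ s≤1 (s≤1⇒1≤s s≉0 s≤1)

    nonzero⇒one : ∀ t → ¬ t ≈ 0# → t ≈ 1#
    nonzero⇒one t t≉0 = comparable-with-one⇒one t≉0 (inj₂ (1# , t+1≈1))
      where
      1+t≉0 : ¬ (1# + t) ≈ 0#
      1+t≉0 1+t≈0 = 0≉1 (antisym 0# 1# (1# , +-identityˡ 1#) (t , 1+t≈0))

      t+1≈1 : t + 1# ≈ 1#
      t+1≈1 = trans (+-comm t 1#) (comparable-with-one⇒one 1+t≉0 (inj₁ (t , refl)))

proposition14 : {c ℓ : Level} (K : CommutativeSemiring c ℓ) →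
    let open Semantics K in
    ZeroNeOne → NaturallyOrdered → AtLeastThree → ¬ HasGaifmanNF psi
proposition14 K 0≉1 ordered three (g , g≡psi) =
  nonzero-is-one⇒¬AtLeastThree K (nonzero⇒one K 0≉1 ordered g g≡psi) three
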